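{- Let $n\geq 8$ and $k\in\{0,1,2\}$. Then every strong tournament on $n$ vertices has at most $2(k+1)$ vertices of score at least $n-2-k$.
   Context: A tournament is a directed graph with exactly one arc between every pair of distinct vertices. It is strong if there is a directed path between any two vertices. The score of a vertex is its out-degree. -}

module Defs where

open import Data.Nat using (ℕ; _∸_; _≤_; _≤?_)
open import Data.Fin using (Fin)
open import Data.Bool using (Bool; true; false)
open import Data.List using (List; length; filter)
open import Data.List.Base using () renaming (allFin to allFinL)
open import Data.Bool.Properties using () renaming (_≟_ to _≟ᵇ_)
open import Relation.Binary.PropositionalEquality using (_≡_; _≢_)
open import Relation.Nullary using (¬_)

-- A digraph on vertex set Fin n: arc i → j iff A i j ≡ true.
Digraph : ℕ → Set
Digraph n = Fin n → Fin n → Bool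

record IsTournament {n : ℕ} (A : Digraph n) : Set where
  field
    irrefl : ∀ i → A i i ≡ false
    one-arc : ∀ i j → i ≢ j → ¬ (A i j ≡ A j i)

data Reach {n : ℕ} (A : Digraph n) : Fin n → Fin n → Set where
  here : ∀ {u} → Reach A u u
  step : ∀ {u w v} → A u w ≡ true → Reach A w v → Reach A u v

IsStrong : ∀ {n} → Digraph n → Set
IsStrong A = ∀ u v → Reach A u v

score : ∀ {n} → Digraph n → Fin n → ℕ
score {n} A i = length (filter (λ j → A i j ≟ᵇ true) (allFinL n))

numScoreAtLeast : ∀ {n} → Digraph n → ℕ → ℕ
numScoreAtLeast {n} A s = length (filter (λ i → s ≤? score A i) (allFinL n))

module Submission where

-- A vertex of score at least n - 2 - k is beaten by at most c = k + 1
-- vertices.  Let S be any set of vertices each beaten by at most c vertices,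
-- and t = |S|.  Counting the arcs that end in S, the C(t,2) arcs inside S
-- plus the arcs entering S from outside number at most t·c:
--
--     C(t,2) + #(arcs entering S) ≤ t·c.                            (*)
--
-- Since 2·C(t,2) + t = t², (*) gives t ≤ 2c + 1, and t ≤ 2c as soon as at
-- least one arc enters S.  If S is the whole vertex set this says
-- n ≤ 2k + 3 ≤ 7, contradicting n ≥ 8.  Otherwise some vertex lies outside
-- S, and in a strong tournament a path from it into S (when S is nonempty)
-- crosses into S along an arc, so t ≤ 2c = 2(k + 1).

open import Defs
open import Data.Nat using (ℕ; zero; suc; _≤_; _∸_; _*_; _+_; z≤n; s≤s; s≤s⁻¹; _≤?_)
open import Data.Nat.Properties
open import Data.Nat.Combinatorics using (_C_; nC1≡n; nCk+nC[k+1]≡[n+1]C[k+1])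
open import Data.Nat.Solver using (module +-*-Solver)
open import Algebra.Properties.CommutativeSemigroup +-commutativeSemigroup
  using (interchange; x∙yz≈y∙xz)
open import Data.Bool using (Bool; true; false)
open import Data.Bool.Properties using () renaming (_≟_ to _≟ᵇ_)
open import Data.Fin using (Fin)
open import Data.Fin.Properties using (all?; any?; ¬∀⟶∃¬)
open import Data.List using (List; []; _∷_; length; filter)
open import Data.List.Base using () renaming (allFin to allFinL)
open import Data.List.Properties using (length-tabulate; filter-all; filter-none)
open import Data.List.Membership.Propositional using (_∈_)
open import Data.List.Membership.Propositional.Properties
  using (∈-allFin; ∈-filter⁺; ∈-filter⁻)
open import Data.List.Relation.Unary.All as All using (All; []; _∷_)
open import Data.List.Relation.Unary.Any using (here; there)
open import Data.List.Relation.Unary.AllPairs using (_∷_)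
open import Data.List.Relation.Unary.Unique.Propositional using (Unique)
import Data.List.Relation.Unary.Unique.Propositional.Properties as Unique
open import Data.Product using (∃₂; _×_; _,_; proj₂)
open import Data.Empty using (⊥-elim)
open import Function using (id)
open import Relation.Nullary using (¬_; Dec; yes; no)
open import Relation.Unary using (Pred; Decidable)
open import Relation.Unary.Properties using (∁?)
open import Relation.Binary.PropositionalEquality
open import Level using (Level)

bit : Bool → ℕ
bit true  = 1
bit false = 0

sumOver : {X : Set} → (X → ℕ) → List X → ℕ
sumOver g []       = 0
sumOver g (x ∷ xs) = g x + sumOver g xs

count : {X : Set} → (X → Bool) → List X → ℕ
count f = sumOver (λ x → bit (f x))

module _ {X : Set} where

  sumOver-cong : {f g : X → ℕ} → (∀ x → f x ≡ g x) → ∀ L → sumOver f L ≡ sumOver g L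
  sumOver-cong f≡g []       = refl
  sumOver-cong f≡g (x ∷ xs) = cong₂ _+_ (f≡g x) (sumOver-cong f≡g xs)

  sumOver-+ : (f g : X → ℕ) → ∀ L →
    sumOver (λ x → f x + g x) L ≡ sumOver f L + sumOver g L
  sumOver-+ f g []       = refl
  sumOver-+ f g (x ∷ xs) =
    trans (cong (f x + g x +_) (sumOver-+ f g xs))
          (interchange (f x) (g x) (sumOver f xs) (sumOver g xs))

  sumOver-≤ : (g : X → ℕ) (c : ℕ) {L : List X} →
    All (λ x → g x ≤ c) L → sumOver g L ≤ length L * c
  sumOver-≤ g c []         = z≤n
  sumOver-≤ g c (gx≤c ∷ h) = +-mono-≤ gx≤c (sumOver-≤ g c h)

  sumOver-≥ : (g : X → ℕ) {x : X} {L : List X} → x ∈ L → g x ≤ sumOver g L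
  sumOver-≥ g               (here refl) = m≤m+n _ _
  sumOver-≥ g {L = y ∷ ys}  (there x∈L) = ≤-trans (sumOver-≥ g x∈L) (m≤n+m _ (g y))

  count-pos : (f : X → Bool) {x : X} {L : List X} → x ∈ L → f x ≡ true → 1 ≤ count f L
  count-pos f {x} {L} x∈L fx≡true =
    subst (λ b → bit b ≤ count f L) fx≡true (sumOver-≥ (λ y → bit (f y)) x∈L)

  length-filter-true : (f : X → Bool) → ∀ L →
    length (filter (λ x → f x ≟ᵇ true) L) ≡ count f L
  length-filter-true f []       = refl
  length-filter-true f (x ∷ xs) with f x
  ... | true  = cong suc (length-filter-true f xs)
  ... | false = length-filter-true f xs

  sumOver-partition : {p : Level} {P : Pred X p} (P? : Decidable P) (g : X → ℕ) → ∀ L →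
    sumOver g L ≡ sumOver g (filter P? L) + sumOver g (filter (∁? P?) L)
  sumOver-partition P? g []       = refl
  sumOver-partition P? g (x ∷ xs) with P? x
  ... | yes _ = trans (cong (g x +_) (sumOver-partition P? g xs))
                      (sym (+-assoc (g x) (sumOver g (filter P? xs)) _))
  ... | no  _ = trans (cong (g x +_) (sumOver-partition P? g xs))
                      (x∙yz≈y∙xz (g x) (sumOver g (filter P? xs)) _)

pairs-suc : ∀ t → t + t C 2 ≡ suc t C 2
pairs-suc t = trans (cong (_+ t C 2) (sym (nC1≡n t))) (nCk+nC[k+1]≡[n+1]C[k+1] t 1)

doubled-pairs : ∀ t → 2 * (t C 2) + t ≡ t * t
doubled-pairs zero    = refl
doubled-pairs (suc t) = begin
  2 * (suc t C 2) + suc t           ≡⟨ cong (λ p → 2 * p + suc t) (sym (pairs-suc t)) ⟩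
  2 * (t + t C 2) + suc t           ≡⟨ solve 2 (λ t p → con 2 :* (t :+ p) :+ (con 1 :+ t)
                                                  := (con 2 :* p :+ t) :+ (con 1 :+ con 2 :* t))
                                               refl t (t C 2) ⟩
  2 * (t C 2) + t + (1 + 2 * t)     ≡⟨ cong (_+ (1 + 2 * t)) (doubled-pairs t) ⟩
  t * t + (1 + 2 * t)               ≡⟨ solve 1 (λ t → t :* t :+ (con 1 :+ con 2 :* t)
                                                  := (con 1 :+ t) :* (con 1 :+ t)) refl t ⟩
  suc t * suc t                     ∎
  where
  open ≡-Reasoning
  open +-*-Solver

pairs-bound : ∀ t c e → t C 2 + e ≤ t * c → t * t + 2 * e ≤ t * suc (2 * c)
pairs-bound t c e h = begin
  t * t + 2 * e              ≡⟨ cong (_+ 2 * e) (sym (doubled-pairs t)) ⟩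
  2 * (t C 2) + t + 2 * e    ≡⟨ solve 3 (λ p t e → con 2 :* p :+ t :+ con 2 :* e
                                           := con 2 :* (p :+ e) :+ t) refl (t C 2) t e ⟩
  2 * (t C 2 + e) + t        ≤⟨ +-monoˡ-≤ t (*-monoʳ-≤ 2 h) ⟩
  2 * (t * c) + t            ≡⟨ solve 2 (λ t c → con 2 :* (t :* c) :+ t
                                           := t :* (con 1 :+ con 2 :* c)) refl t c ⟩
  t * suc (2 * c)            ∎
  where
  open ≤-Reasoning
  open +-*-Solver

pairs-≤ : ∀ t c → t C 2 ≤ t * c → t ≤ suc (2 * c)
pairs-≤ zero    c h = z≤n
pairs-≤ (suc t) c h = *-cancelˡ-≤ (suc t) (subst (_≤ suc t * suc (2 * c)) (+-identityʳ _) squares)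
  where
  squares : suc t * suc t + 0 ≤ suc t * suc (2 * c)
  squares = pairs-bound (suc t) c 0 (subst (_≤ suc t * c) (sym (+-identityʳ _)) h)

pairs-< : ∀ t c → t C 2 + 1 ≤ t * c → t ≤ 2 * c
pairs-< t c h =
  s≤s⁻¹ (*-cancelˡ-< t t (suc (2 * c))
          (≤-trans (m<m+n (t * t) (s≤s z≤n)) (pairs-bound t c 1 h)))

-- If a + b = m - 1 and a ≥ m - 1 - c then b ≤ c; this turns a lower bound
-- on the score into an upper bound on the in-degree.
complement-bound : ∀ {m c a b} → m ∸ suc c ≤ a → suc (a + b) ≡ m → b ≤ c
complement-bound {c = c} {a} {b} a≥ refl = +-cancelˡ-≤ a b c (begin
  a + b             ≤⟨ m≤n+m∸n (a + b) c ⟩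
  c + (a + b ∸ c)   ≤⟨ +-monoʳ-≤ c a≥ ⟩
  c + a             ≡⟨ +-comm c a ⟩
  a + c             ∎)
  where open ≤-Reasoning

cut-arc : ∀ {n} (A : Digraph n) {p} {P : Pred (Fin n) p} → Decidable P →
  ∀ {w v} → Reach A w v → ¬ P w → P v →
  ∃₂ λ u v′ → ¬ P u × P v′ × A u v′ ≡ true
cut-arc A P? here ¬Pw Pv = ⊥-elim (¬Pw Pv)
cut-arc A P? (step {w = x} w→x x⇝v) ¬Pw Pv with P? x
... | yes Px  = _ , x , ¬Pw , Px , w→x
... | no  ¬Px = cut-arc A P? x⇝v ¬Px Pv

-- Degree counting in a tournament.  Degrees are taken relative to a list L
-- of vertices: only neighbours in L are counted.
module Tournament {n : ℕ} (A : Digraph n) (T : IsTournament A) where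
  open IsTournament T

  outDeg inDeg : List (Fin n) → Fin n → ℕ
  outDeg L i = count (A i) L
  inDeg  L i = count (λ j → A j i) L

  V : List (Fin n)
  V = allFinL n

  arc-count : ∀ {i j} → i ≢ j → bit (A i j) + bit (A j i) ≡ 1
  arc-count {i} {j} i≢j with A i j in eij | A j i in eji
  ... | true  | false = refl
  ... | false | true  = refl
  ... | true  | true  = ⊥-elim (one-arc i j i≢j (trans eij (sym eji)))
  ... | false | false = ⊥-elim (one-arc i j i≢j (trans eij (sym eji)))

  degree-outside : ∀ {i L} → All (i ≢_) L → outDeg L i + inDeg L i ≡ length L
  degree-outside []                  = refl
  degree-outside {i} {x ∷ xs} (i≢x ∷ h) =
    trans (interchange (bit (A i x)) (outDeg xs i) (bit (A x i)) (inDeg xs i))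
          (cong₂ _+_ (arc-count i≢x) (degree-outside h))

  degree-inside : ∀ {i L} → Unique L → i ∈ L → suc (outDeg L i + inDeg L i) ≡ length L
  degree-inside {i} (i∉xs ∷ _) (here refl) rewrite irrefl i = cong suc (degree-outside i∉xs)
  degree-inside {i} {x ∷ xs} (x∉xs ∷ u) (there i∈xs) =
    cong suc (trans (interchange (bit (A i x)) (outDeg xs i) (bit (A x i)) (inDeg xs i))
                    (trans (cong (_+ (outDeg xs i + inDeg xs i)) (arc-count i≢x))
                           (degree-inside u i∈xs)))
    where
    i≢x : i ≢ x
    i≢x refl = All.lookup x∉xs i∈xs refl

  handshake : ∀ {L} → Unique L → sumOver (inDeg L) L ≡ length L C 2
  handshake {[]} _ = refl
  handshake {x ∷ xs} (x∉xs ∷ u) = begin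
    inDeg (x ∷ xs) x + sumOver (λ v → bit (A x v) + inDeg xs v) xs
      ≡⟨ cong₂ _+_ (cong (_+ inDeg xs x) (cong bit (irrefl x))) (sumOver-+ _ _ xs) ⟩
    inDeg xs x + (outDeg xs x + sumOver (inDeg xs) xs)
      ≡⟨ x∙yz≈y∙xz (inDeg xs x) (outDeg xs x) _ ⟩
    outDeg xs x + (inDeg xs x + sumOver (inDeg xs) xs)
      ≡⟨ sym (+-assoc (outDeg xs x) _ _) ⟩
    outDeg xs x + inDeg xs x + sumOver (inDeg xs) xs
      ≡⟨ cong₂ _+_ (degree-outside x∉xs) (handshake u) ⟩
    length xs + length xs C 2
      ≡⟨ pairs-suc (length xs) ⟩
    suc (length xs) C 2 ∎
    where open ≡-Reasoning

  high-score⇒few-in-arcs : ∀ k v → n ∸ 2 ∸ k ≤ score A v → inDeg V v ≤ k + 1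
  high-score⇒few-in-arcs k v high = complement-bound high′ degree-sum
    where
    degree-sum : suc (score A v + inDeg V v) ≡ n
    degree-sum = trans (cong (λ s → suc (s + inDeg V v)) (length-filter-true (A v) V))
                       (trans (degree-inside (Unique.allFin⁺ n) (∈-allFin v)) (length-tabulate id))
    threshold : n ∸ 2 ∸ k ≡ n ∸ suc (k + 1)
    threshold = trans (∸-+-assoc n 2 k) (cong (λ m → n ∸ suc m) (+-comm 1 k))
    high′ : n ∸ suc (k + 1) ≤ score A v
    high′ = subst (_≤ score A v) threshold high

module FewInArcs {n : ℕ} (A : Digraph n) (T : IsTournament A)
    {p} {P : Pred (Fin n) p} (P? : Decidable P) (c : ℕ)
    (few-in-arcs : ∀ v → P v → Tournament.inDeg A T (allFinL n) v ≤ c) where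
  open Tournament A T

  S S̄ : List (Fin n)
  S = filter P? V
  S̄ = filter (∁? P?) V

  in-arcs-bound : length S C 2 + sumOver (inDeg S̄) S ≤ length S * c
  in-arcs-bound = begin
    length S C 2 + sumOver (inDeg S̄) S
      ≡⟨ cong (_+ sumOver (inDeg S̄) S) (sym (handshake (Unique.filter⁺ P? (Unique.allFin⁺ n)))) ⟩
    sumOver (inDeg S) S + sumOver (inDeg S̄) S
      ≡⟨ sym (sumOver-+ (inDeg S) (inDeg S̄) S) ⟩
    sumOver (λ v → inDeg S v + inDeg S̄ v) S
      ≡⟨ sumOver-cong (λ v → sym (sumOver-partition P? (λ u → bit (A u v)) V)) S ⟩
    sumOver (inDeg V) S
      ≤⟨ sumOver-≤ (inDeg V) c {S}
           (All.tabulate (λ v∈S → few-in-arcs _ (proj₂ (∈-filter⁻ P? {xs = V} v∈S)))) ⟩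
    length S * c ∎
    where open ≤-Reasoning

  everywhere-bound : (∀ v → P v) → n ≤ suc (2 * c)
  everywhere-bound everywhere =
    pairs-≤ n c (subst (λ t → t C 2 ≤ t * c) |S|≡n (≤-trans (m≤m+n _ _) in-arcs-bound))
    where
    |S|≡n : length S ≡ n
    |S|≡n = trans (cong length (filter-all P? {V} (All.tabulate (λ {v} _ → everywhere v))))
                  (length-tabulate id)

  -- If the tournament is strong and some vertex lies outside S then |S| ≤ 2c:
  -- either S is empty, or a path from outside into S yields an entering arc.
  cut-bound : IsStrong A → ∀ w → ¬ P w → length S ≤ 2 * c
  cut-bound strong w ¬Pw with any? P?
  ... | no nowhere = ≤-trans (≤-reflexive (cong length S≡[])) z≤n
    where
    S≡[] : S ≡ []
    S≡[] = filter-none P? {V} (All.tabulate (λ {v} _ Pv → nowhere (v , Pv)))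
  ... | yes (v , Pv) with cut-arc A P? (strong w v) ¬Pw Pv
  ... | u , v′ , ¬Pu , Pv′ , u→v′ =
    pairs-< (length S) c (≤-trans (+-monoʳ-≤ (length S C 2) entering) in-arcs-bound)
    where
    entering : 1 ≤ sumOver (inDeg S̄) S
    entering = ≤-trans (count-pos (λ x → A x v′) {L = S̄} (∈-filter⁺ (∁? P?) (∈-allFin u) ¬Pu) u→v′)
                       (sumOver-≥ (inDeg S̄) {L = S} (∈-filter⁺ P? (∈-allFin v′) Pv′))

high? : ∀ {n} (A : Digraph n) (s : ℕ) → Decidable (λ v → s ≤ score A v)
high? A s v = s ≤? score A v

lemma3 : (n k : ℕ) → 8 ≤ n → k ≤ 2 → (A : Digraph n) →
    IsTournament A → IsStrong A →
    numScoreAtLeast A (n ∸ 2 ∸ k) ≤ 2 * (k + 1)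
lemma3 n k 8≤n k≤2 A T strong = by-cases (all? (high? A (n ∸ 2 ∸ k)))
  where
  open FewInArcs A T (high? A (n ∸ 2 ∸ k)) (k + 1) (Tournament.high-score⇒few-in-arcs A T k)

  2k+3≤7 : suc (2 * (k + 1)) ≤ 7
  2k+3≤7 = s≤s (*-monoʳ-≤ 2 (+-monoˡ-≤ 1 k≤2))

  by-cases : Dec (∀ v → n ∸ 2 ∸ k ≤ score A v) → length S ≤ 2 * (k + 1)
  by-cases (yes allHigh)   = ⊥-elim (1+n≰n (≤-trans 8≤n n≤7))
    where
    n≤7 : n ≤ 7
    n≤7 = ≤-trans (everywhere-bound allHigh) 2k+3≤7
  by-cases (no notAllHigh) with ¬∀⟶∃¬ n _ (high? A (n ∸ 2 ∸ k)) notAllHigh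
  ... | w , ¬high = cut-bound strong w ¬high
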